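{- For every integer $k \geq 0$, there exists a graph $G_k$ having an induced subgraph $H_k$ such that $\chi_L(H_k) - \chi_L(G_k) = k$ and $\chi_{NL}(H_k) - \chi_{NL}(G_k) = k$.
   Context: All graphs are finite and simple. For a proper $k$-coloring $f$ of $G$ with color classes $S_1,\dots,S_k$, two vertices $x,y$ are metric-distinguished if $d(x,S_i)\neq d(y,S_i)$ for some $i$, where $d(x,S)=\min\{d(x,z): z\in S\}$ and $d$ is the shortest-path distance; $f$ is a locating $k$-coloring if any two distinct vertices are metric-distinguished, and $\chi_L(G)$ is the minimum $k$ for which $G$ admits a locating $k$-coloring. For a vertex $x$, let $N_f(x)=\{f(y): y \text{ adjacent to } x\}$. Two vertices $x,y$ are neighbor-distinguished if $f(x)\neq f(y)$ or $N_f(x)\neq N_f(y)$; $f$ is a neighbor-locating $k$-coloring if every two distinct vertices are neighbor-distinguished, and $\chi_{NL}(G)$ is the minimum $k$ for which $G$ admits a neighbor-locating $k$-coloring. -}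

module Defs where

open import Data.Nat using (ℕ; zero; suc; _≤_)
open import Data.Fin using (Fin)
open import Data.Bool using (Bool; true; false)
open import Data.Maybe using (Maybe; just; nothing)
open import Data.Product using (Σ; _×_; _,_)
open import Data.Sum using (_⊎_)
open import Relation.Nullary using (¬_)
open import Relation.Binary.PropositionalEquality using (_≡_; _≢_)
open import Function.Definitions using (Injective)

record Graph : Set where
  field
    n     : ℕ
    adj   : Fin n → Fin n → Bool
    sym   : ∀ x y → adj x y ≡ adj y x
    irrefl : ∀ x → adj x x ≡ false
open Graph public

record InducedSubgraph (H G : Graph) : Set where
  field
    emb      : Fin (n H) → Fin (n G)
    emb-inj  : Injective _≡_ _≡_ emb
    emb-adj  : ∀ u v → adj H u v ≡ adj G (emb u) (emb v)

data Walk (G : Graph) : Fin (n G) → Fin (n G) → ℕ → Set where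
  nil  : ∀ {x} → Walk G x x 0
  cons : ∀ {x y z m} → adj G x y ≡ true → Walk G y z m → Walk G x z (suc m)

Coloring : Graph → ℕ → Set
Coloring G k = Fin (n G) → Fin k

Proper : (G : Graph) {k : ℕ} → Coloring G k → Set
Proper G f = ∀ x y → adj G x y ≡ true → f x ≢ f y

-- DistToClass G f x i d : d is the distance d(x, S_i) from x to the colour
-- class S_i = f⁻¹(i); 'just m' = m (shortest-path distance, realised by a
-- shortest walk), 'nothing' = ∞ (no vertex of S_i reachable from x).
DistToClass : (G : Graph) {k : ℕ} → Coloring G k → Fin (n G) → Fin k → Maybe ℕ → Set
DistToClass G f x i (just m) =
  (Σ (Fin (n G)) λ z → f z ≡ i × Walk G x z m) ×
  (∀ z j → f z ≡ i → Walk G x z j → m ≤ j)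
DistToClass G f x i nothing = ∀ z j → f z ≡ i → ¬ Walk G x z j

MetricDistinguished : (G : Graph) {k : ℕ} → Coloring G k → Fin (n G) → Fin (n G) → Set
MetricDistinguished G {k} f x y =
  Σ (Fin k) λ i → ∀ a b → DistToClass G f x i a → DistToClass G f y i b → a ≢ b

IsLocatingColoring : (G : Graph) {k : ℕ} → Coloring G k → Set
IsLocatingColoring G f =
  Proper G f × (∀ x y → x ≢ y → MetricDistinguished G f x y)

HasLocatingColoring : Graph → ℕ → Set
HasLocatingColoring G k = Σ (Coloring G k) λ f → IsLocatingColoring G f

InNf : (G : Graph) {k : ℕ} → Coloring G k → Fin (n G) → Fin k → Set
InNf G f x c = Σ (Fin (n G)) λ y → adj G x y ≡ true × f y ≡ c

SameNf : (G : Graph) {k : ℕ} → Coloring G k → Fin (n G) → Fin (n G) → Set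
SameNf G {k} f x y = ∀ (c : Fin k) → (InNf G f x c → InNf G f y c) × (InNf G f y c → InNf G f x c)

NeighborDistinguished : (G : Graph) {k : ℕ} → Coloring G k → Fin (n G) → Fin (n G) → Set
NeighborDistinguished G f x y = f x ≢ f y ⊎ ¬ SameNf G f x y

IsNeighborLocatingColoring : (G : Graph) {k : ℕ} → Coloring G k → Set
IsNeighborLocatingColoring G f =
  Proper G f × (∀ x y → x ≢ y → NeighborDistinguished G f x y)

HasNeighborLocatingColoring : Graph → ℕ → Set
HasNeighborLocatingColoring G k = Σ (Coloring G k) λ f → IsNeighborLocatingColoring G f

IsLeast : (ℕ → Set) → ℕ → Set
IsLeast P k = P k × (∀ j → P j → k ≤ j)

LocatingChromaticNumber : Graph → ℕ → Set
LocatingChromaticNumber G = IsLeast (HasLocatingColoring G)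

NeighborLocatingChromaticNumber : Graph → ℕ → Set
NeighborLocatingChromaticNumber G = IsLeast (HasNeighborLocatingColoring G)

-- A vertex whose neighbourhood contains a colour c that another vertex does
-- not see lies at distance 1 from the class of c while the other does not,
-- so such "neighbourhood separation" (or distinct colours) distinguishes
-- vertices both metrically and by neighbour colours.  The graph G_k is a
-- clique on k+2 vertices, coloured injectively, together with k+2 isolated
-- vertices (one of each colour) and k pendant vertices of colour 0 hanging
-- from distinct clique vertices 1,…,k; neighbourhood separation shows this
-- colouring is locating and neighbour-locating, and the clique shows that
-- k+2 colours are needed.  The 2k+2 non-clique vertices are independent and
-- induce an edgeless graph, whose locating and neighbour-locating colourings
-- must be injective, so both parameters jump from k+2 to 2k+2.
module Submission where

open import Defs
open import Data.Bool using (Bool; true; false; not)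
open import Data.Fin using (Fin; zero; suc; inject₁; fromℕ; splitAt; _≟_)
open import Data.Fin.Properties
  using (+↔⊎; injective⇒≤; suc-injective; inject₁-injective; fromℕ≢inject₁)
open import Data.Maybe using (Maybe; just; nothing)
open import Data.Nat using (ℕ; suc; _+_; _≤_; z≤n; s≤s)
open import Data.Nat.Properties using (n≤0⇒n≡0)
open import Data.Product using (Σ; _×_; _,_; proj₁; proj₂)
open import Data.Sum using (_⊎_; inj₁; inj₂; [_,_])
open import Data.Sum.Function.Propositional using (_⊎-↔_)
open import Data.Sum.Properties using (inj₂-injective)
open import Data.Empty using (⊥-elim)
open import Function using (_∘_; id)
open import Function.Bundles using (Inverse; Injection; _↔_; mk⇔)
open import Function.Definitions using (Injective)
open import Function.Properties.Inverse using (↔-refl; ↔-sym; ↔-trans; ↔⇒↣)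
open import Relation.Binary.PropositionalEquality
  using (_≡_; _≢_; refl; trans; cong; cong₂; subst; subst₂) renaming (sym to ≡-sym)
open import Relation.Nullary using (¬_; Dec; yes; no; does)
open import Relation.Nullary.Decidable using (dec-true; dec-false; does-⇔; decidable-stable)

module _ (G : Graph) {k : ℕ} (f : Coloring G k) where

  Separates : Fin k → Fin (n G) → Fin (n G) → Set
  Separates c x y = InNf G f x c × ¬ InNf G f y c

  Separated : Fin (n G) → Fin (n G) → Set
  Separated x y = f x ≢ f y ⊎ Σ (Fin k) λ c → Separates c x y ⊎ Separates c y x

  IsSeparatingColoring : Set
  IsSeparatingColoring = Proper G f × (∀ x y → x ≢ y → Separated x y)

  Separated-sym : ∀ {x y} → Separated x y → Separated y x
  Separated-sym (inj₁ fx≢fy)      = inj₁ (fx≢fy ∘ ≡-sym)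
  Separated-sym (inj₂ (c , inj₁ s)) = inj₂ (c , inj₂ s)
  Separated-sym (inj₂ (c , inj₂ s)) = inj₂ (c , inj₁ s)

  walk₀-endpoints : ∀ {x z} → Walk G x z 0 → x ≡ z
  walk₀-endpoints nil = refl

  walk₁-edge : ∀ {x z} → Walk G x z 1 → adj G x z ≡ true
  walk₁-edge (cons e nil) = e

  dist-own-class : ∀ {x a} → DistToClass G f x (f x) a → a ≡ just 0
  dist-own-class {x} {nothing} unreachable  = ⊥-elim (unreachable x 0 refl nil)
  dist-own-class {x} {just m}  (_ , minimal) = cong just (n≤0⇒n≡0 (minimal x 0 refl nil))

  dist-zero⇒in-class : ∀ {x i} → DistToClass G f x i (just 0) → f x ≡ i
  dist-zero⇒in-class ((z , fz≡i , w) , _) with refl ← walk₀-endpoints w = fz≡i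

  dist-one⇒InNf : ∀ {x i} → DistToClass G f x i (just 1) → InNf G f x i
  dist-one⇒InNf ((z , fz≡i , w) , _) = z , walk₁-edge w , fz≡i

  dist-neighbour-class : ∀ {x i a} → f x ≢ i → InNf G f x i → DistToClass G f x i a → a ≡ just 1
  dist-neighbour-class {a = nothing} _ (z , e , fz≡i) unreachable =
    ⊥-elim (unreachable z 1 fz≡i (cons e nil))
  dist-neighbour-class {a = just 0} fx≢i _ d = ⊥-elim (fx≢i (dist-zero⇒in-class d))
  dist-neighbour-class {a = just 1} _ _ _ = refl
  dist-neighbour-class {a = just (suc (suc _))} _ (z , e , fz≡i) (_ , minimal)
    with s≤s () ← minimal z 1 fz≡i (cons e nil)

  InNf⇒colour≢ : Proper G f → ∀ {x c} → InNf G f x c → f x ≢ c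
  InNf⇒colour≢ proper {x} (y , e , fy≡c) fx≡c = proper x y e (trans fx≡c (≡-sym fy≡c))

  own-class-dist≢ : ∀ {x y a b} → f x ≢ f y →
                    DistToClass G f x (f x) a → DistToClass G f y (f x) b → a ≢ b
  own-class-dist≢ fx≢fy dx dy refl with refl ← dist-own-class dx =
    fx≢fy (≡-sym (dist-zero⇒in-class dy))

  separates⇒dist≢ : Proper G f → ∀ {c x y a b} → Separates c x y →
                    DistToClass G f x c a → DistToClass G f y c b → a ≢ b
  separates⇒dist≢ proper (x∼c , y≁c) dx dy refl
    with refl ← dist-neighbour-class (InNf⇒colour≢ proper x∼c) x∼c dx = y≁c (dist-one⇒InNf dy)

  separated⇒metric : Proper G f → ∀ {x y} → Separated x y → MetricDistinguished G f x y
  separated⇒metric _      {x} (inj₁ fx≢fy)  = f x , λ _ _ → own-class-dist≢ fx≢fy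
  separated⇒metric proper (inj₂ (c , inj₁ s)) = c , λ _ _ → separates⇒dist≢ proper s
  separated⇒metric proper (inj₂ (c , inj₂ s)) =
    c , λ _ _ dx dy a≡b → separates⇒dist≢ proper s dy dx (≡-sym a≡b)

  separated⇒neighbor : ∀ {x y} → Separated x y → NeighborDistinguished G f x y
  separated⇒neighbor (inj₁ fx≢fy)                  = inj₁ fx≢fy
  separated⇒neighbor (inj₂ (c , inj₁ (x∼c , y≁c))) = inj₂ λ same → y≁c (proj₁ (same c) x∼c)
  separated⇒neighbor (inj₂ (c , inj₂ (y∼c , x≁c))) = inj₂ λ same → x≁c (proj₂ (same c) y∼c)

  separating⇒locating : IsSeparatingColoring → IsLocatingColoring G f
  separating⇒locating (proper , separated) =
    proper , λ x y x≢y → separated⇒metric proper (separated x y x≢y)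

  separating⇒neighborLocating : IsSeparatingColoring → IsNeighborLocatingColoring G f
  separating⇒neighborLocating (proper , separated) =
    proper , λ x y x≢y → separated⇒neighbor (separated x y x≢y)

record Clique (G : Graph) (m : ℕ) : Set where
  field
    member   : Fin m → Fin (n G)
    adjacent : ∀ i j → i ≢ j → adj G (member i) (member j) ≡ true

clique-size≤colours : ∀ {G m k} → Clique G m → (f : Coloring G k) → Proper G f → m ≤ k
clique-size≤colours K f proper = injective⇒≤ λ {i} {j} fi≡fj →
  decidable-stable (i ≟ j) λ i≢j → proper (member i) (member j) (adjacent i j i≢j) fi≡fj
  where open Clique K

χ-by-clique : ∀ {G m} → Clique G m → (f : Coloring G m) → IsSeparatingColoring G f →
              LocatingChromaticNumber G m × NeighborLocatingChromaticNumber G m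
χ-by-clique {G} K f separating =
  ((f , separating⇒locating G f separating) , λ _ (g , proper , _) → clique-size≤colours K g proper) ,
  ((f , separating⇒neighborLocating G f separating) , λ _ (g , proper , _) → clique-size≤colours K g proper)

Edgeless : ℕ → Graph
Edgeless m = record { n = m ; adj = λ _ _ → false ; sym = λ _ _ → refl ; irrefl = λ _ → refl }

edgeless-walk-endpoints : ∀ {m} {x z : Fin m} {j} → Walk (Edgeless m) x z j → x ≡ z
edgeless-walk-endpoints nil = refl

edgelessDist : ∀ {k} → Fin k → Fin k → Maybe ℕ
edgelessDist c i with c ≟ i
... | yes _ = just 0
... | no _  = nothing

edgeless-dist : ∀ {m k} (f : Coloring (Edgeless m) k) x i →
                DistToClass (Edgeless m) f x i (edgelessDist (f x) i)
edgeless-dist f x i with f x ≟ i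
... | yes fx≡i = (x , fx≡i , nil) , λ _ _ _ _ → z≤n
... | no fx≢i  = λ z _ fz≡i w → fx≢i (subst (λ t → f t ≡ i) (≡-sym (edgeless-walk-endpoints w)) fz≡i)

edgeless-locating⇒injective : ∀ {m k} (f : Coloring (Edgeless m) k) →
                              IsLocatingColoring (Edgeless m) f → Injective _≡_ _≡_ f
edgeless-locating⇒injective f (_ , distinguished) {x} {y} fx≡fy = decidable-stable (x ≟ y) λ x≢y →
  let (i , dist≢) = distinguished x y x≢y
  in dist≢ _ _ (edgeless-dist f x i) (edgeless-dist f y i) (cong (λ c → edgelessDist c i) fx≡fy)

edgeless-SameNf : ∀ {m k} (f : Coloring (Edgeless m) k) x y → SameNf (Edgeless m) f x y
edgeless-SameNf f x y c = (λ { (_ , () , _) }) , (λ { (_ , () , _) })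

edgeless-neighborLocating⇒injective : ∀ {m k} (f : Coloring (Edgeless m) k) →
                                       IsNeighborLocatingColoring (Edgeless m) f → Injective _≡_ _≡_ f
edgeless-neighborLocating⇒injective f (_ , distinguished) {x} {y} fx≡fy =
  decidable-stable (x ≟ y) λ x≢y →
  [ (λ fx≢fy → fx≢fy fx≡fy) , (λ ¬same → ¬same (edgeless-SameNf f x y)) ] (distinguished x y x≢y)

edgeless-χ : ∀ m → LocatingChromaticNumber (Edgeless m) m × NeighborLocatingChromaticNumber (Edgeless m) m
edgeless-χ m =
  ((id , separating⇒locating (Edgeless m) id id-separating) ,
    λ _ (f , locating) → injective⇒≤ (edgeless-locating⇒injective f locating)) ,
  ((id , separating⇒neighborLocating (Edgeless m) id id-separating) ,
    λ _ (f , neighborLocating) → injective⇒≤ (edgeless-neighborLocating⇒injective f neighborLocating))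
  where
  id-separating : IsSeparatingColoring (Edgeless m) id
  id-separating = (λ _ _ ()) , λ _ _ x≢y → inj₁ x≢y

independent⇒induced-edgeless : ∀ {G m} (e : Fin m → Fin (n G)) → Injective _≡_ _≡_ e →
                               (∀ i j → adj G (e i) (e j) ≡ false) → InducedSubgraph (Edgeless m) G
independent⇒induced-edgeless e e-injective independent = record
  { emb = e ; emb-inj = e-injective ; emb-adj = λ i j → ≡-sym (independent i j) }

module Enumerated {V : Set} {N : ℕ} (vertices : Fin N ↔ V) (_~_ : V → V → Bool)
                  (~-sym : ∀ a b → a ~ b ≡ b ~ a) (~-irrefl : ∀ a → a ~ a ≡ false) where

  open Inverse vertices using (to; from; strictlyInverseˡ)

  graph : Graph
  graph = record
    { n = N ; adj = λ x y → to x ~ to y ; sym = λ x y → ~-sym (to x) (to y) ; irrefl = ~-irrefl ∘ to }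

  adj-from : ∀ a b → adj graph (from a) (from b) ≡ a ~ b
  adj-from a b = cong₂ _~_ (strictlyInverseˡ a) (strictlyInverseˡ b)

  from-injective : Injective _≡_ _≡_ from
  from-injective = Injection.injective (↔⇒↣ (↔-sym vertices))

  module Colouring {k : ℕ} (colour : V → Fin k) where

    f : Coloring graph k
    f = colour ∘ to

    record Sees (a : V) (c : Fin k) : Set where
      constructor sees
      field
        neighbour : V
        adjacent  : a ~ neighbour ≡ true
        coloured  : colour neighbour ≡ c

    colour-from : ∀ a → f (from a) ≡ colour a
    colour-from a = cong colour (strictlyInverseˡ a)

    Sees⇒InNf : ∀ {a c} → Sees a c → InNf graph f (from a) c
    Sees⇒InNf {a} (sees b a~b colour-b) =
      from b , trans (adj-from a b) a~b , trans (colour-from b) colour-b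

    InNf⇒Sees : ∀ {a c} → InNf graph f (from a) c → Sees a c
    InNf⇒Sees {a} (y , e , fy≡c) =
      sees (to y) (subst (λ a′ → a′ ~ to y ≡ true) (strictlyInverseˡ a) e) fy≡c

    separated-by-colour : ∀ a b → colour a ≢ colour b → Separated graph f (from a) (from b)
    separated-by-colour a b ca≢cb =
      inj₁ λ fa≡fb → ca≢cb (trans (≡-sym (colour-from a)) (trans fa≡fb (colour-from b)))

    separated-by-sight : ∀ a b {c} → Sees a c → ¬ Sees b c → Separated graph f (from a) (from b)
    separated-by-sight a b {c} a-sees b-blind =
      inj₂ (c , inj₁ (Sees⇒InNf a-sees , b-blind ∘ InNf⇒Sees))

    separated-sym : ∀ a b → Separated graph f (from a) (from b) → Separated graph f (from b) (from a)
    separated-sym a b = Separated-sym graph f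

    separating : (∀ a b → a ~ b ≡ true → colour a ≢ colour b) →
                 (∀ a b → a ≢ b → Separated graph f (from a) (from b)) → IsSeparatingColoring graph f
    separating proper separated = (λ x y → proper (to x) (to y)) , λ x y x≢y →
      subst₂ (Separated graph f) (strictlyInverseʳ x) (strictlyInverseʳ y)
             (separated (to x) (to y) (x≢y ∘ Injection.injective (↔⇒↣ vertices)))
      where open Inverse vertices using (strictlyInverseʳ)

does≡true⇒ : ∀ {A : Set} (a? : Dec A) → does a? ≡ true → A
does≡true⇒ (yes a) _ = a

module Construction (k : ℕ) where

  Vertex : Set
  Vertex = Fin (2 + k) ⊎ (Fin (2 + k) ⊎ Fin k)

  pattern clique i   = inj₁ i
  pattern isolated i = inj₂ (inj₁ i)
  pattern pendant m  = inj₂ (inj₂ m)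

  anchor : Fin k → Fin (2 + k)
  anchor m = suc (inject₁ m)

  last : Fin (2 + k)
  last = suc (fromℕ k)

  anchor-injective : Injective _≡_ _≡_ anchor
  anchor-injective = inject₁-injective ∘ suc-injective

  anchor≢last : ∀ m → anchor m ≢ last
  anchor≢last m = fromℕ≢inject₁ ∘ ≡-sym ∘ suc-injective

  other : Fin (2 + k) → Fin (2 + k)
  other zero    = suc zero
  other (suc _) = zero

  other≢ : ∀ i → i ≢ other i
  other≢ zero    ()
  other≢ (suc _) ()

  _~_ : Vertex → Vertex → Bool
  clique i  ~ clique j  = not (does (i ≟ j))
  clique i  ~ pendant m = does (i ≟ anchor m)
  pendant m ~ clique i  = does (i ≟ anchor m)
  _         ~ _         = false

  ~-sym : ∀ a b → a ~ b ≡ b ~ a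
  ~-sym (clique i)   (clique j)   = cong not (does-⇔ (mk⇔ ≡-sym ≡-sym) (i ≟ j) (j ≟ i))
  ~-sym (clique _)   (isolated _) = refl
  ~-sym (clique _)   (pendant _)  = refl
  ~-sym (isolated _) (clique _)   = refl
  ~-sym (isolated _) (isolated _) = refl
  ~-sym (isolated _) (pendant _)  = refl
  ~-sym (pendant _)  (clique _)   = refl
  ~-sym (pendant _)  (isolated _) = refl
  ~-sym (pendant _)  (pendant _)  = refl

  ~-irrefl : ∀ a → a ~ a ≡ false
  ~-irrefl (clique i)   = cong not (dec-true (i ≟ i) refl)
  ~-irrefl (isolated _) = refl
  ~-irrefl (pendant _)  = refl

  clique-adjacent : ∀ {i j} → i ≢ j → clique i ~ clique j ≡ true
  clique-adjacent {i} {j} i≢j = cong not (dec-false (i ≟ j) i≢j)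

  non-clique-independent : ∀ s t → inj₂ s ~ inj₂ t ≡ false
  non-clique-independent (inj₁ _) (inj₁ _) = refl
  non-clique-independent (inj₁ _) (inj₂ _) = refl
  non-clique-independent (inj₂ _) (inj₁ _) = refl
  non-clique-independent (inj₂ _) (inj₂ _) = refl

  colour : Vertex → Fin (2 + k)
  colour (clique i)   = i
  colour (isolated i) = i
  colour (pendant _)  = zero

  colour-proper : ∀ a b → a ~ b ≡ true → colour a ≢ colour b
  colour-proper (clique i) (clique j) e with i ≟ j
  ... | no i≢j = i≢j
  colour-proper (clique i) (pendant m) e with i ≟ anchor m
  ... | yes refl = λ ()
  colour-proper (pendant m) (clique i) e with i ≟ anchor m
  ... | yes refl = λ ()

  vertices : Fin (2 + k + (2 + k + k)) ↔ Vertex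
  vertices = ↔-trans +↔⊎ (↔-refl ⊎-↔ +↔⊎)

  open Enumerated vertices _~_ ~-sym ~-irrefl public
  open Colouring colour public
  open Inverse vertices using (from)

  clique-sees : ∀ {i j} → i ≢ j → Sees (clique i) j
  clique-sees {j = j} i≢j = sees (clique j) (clique-adjacent i≢j) refl

  isolated-blind : ∀ {i c} → ¬ Sees (isolated i) c
  isolated-blind (sees (clique _)   () _)
  isolated-blind (sees (isolated _) () _)
  isolated-blind (sees (pendant _)  () _)

  pendant-sees-anchor : ∀ m → Sees (pendant m) (anchor m)
  pendant-sees-anchor m = sees (clique (anchor m)) (dec-true (anchor m ≟ anchor m) refl) refl

  pendant-sees-only-anchor : ∀ {m c} → Sees (pendant m) c → c ≡ anchor m
  pendant-sees-only-anchor {m} (sees (clique i) e refl) = does≡true⇒ (i ≟ anchor m) e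
  pendant-sees-only-anchor (sees (isolated _) () _)
  pendant-sees-only-anchor (sees (pendant _)  () _)

  separated : ∀ a b → a ≢ b → Separated graph f (from a) (from b)
  separated a@(clique _) b@(clique _) a≢b = separated-by-colour a b (a≢b ∘ cong clique)
  separated a@(clique i) b@(isolated j) _ with i ≟ j
  ... | no i≢j   = separated-by-colour a b i≢j
  ... | yes refl = separated-by-sight a b (clique-sees (other≢ i)) isolated-blind
  separated a@(clique i) b@(pendant m) _ with i ≟ zero
  ... | no i≢0   = separated-by-colour a b i≢0
  ... | yes refl = separated-by-sight a b (clique-sees {j = last} λ ())
                                      (anchor≢last m ∘ ≡-sym ∘ pendant-sees-only-anchor)
  separated a@(isolated _) b@(isolated _) a≢b = separated-by-colour a b (a≢b ∘ cong isolated)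
  separated a@(isolated i) b@(pendant m) _ with i ≟ zero
  ... | no i≢0   = separated-by-colour a b i≢0
  ... | yes refl = separated-sym b a (separated-by-sight b a (pendant-sees-anchor m) isolated-blind)
  separated a@(pendant m) b@(pendant _) a≢b =
    separated-by-sight a b (pendant-sees-anchor m)
                       (a≢b ∘ cong pendant ∘ anchor-injective ∘ pendant-sees-only-anchor)
  separated a@(isolated _) b@(clique _)   a≢b = separated-sym b a (separated b a (a≢b ∘ ≡-sym))
  separated a@(pendant _)  b@(clique _)   a≢b = separated-sym b a (separated b a (a≢b ∘ ≡-sym))
  separated a@(pendant _)  b@(isolated _) a≢b = separated-sym b a (separated b a (a≢b ∘ ≡-sym))

  colour-separating : IsSeparatingColoring graph f
  colour-separating = separating colour-proper separated

  the-clique : Clique graph (2 + k)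
  the-clique = record
    { member   = from ∘ clique
    ; adjacent = λ i j i≢j → trans (adj-from (clique i) (clique j)) (clique-adjacent i≢j)
    }

  non-clique : InducedSubgraph (Edgeless (2 + k + k)) graph
  non-clique = independent⇒induced-edgeless (from ∘ inj₂ ∘ splitAt (2 + k))
    (Injection.injective (↔⇒↣ +↔⊎) ∘ inj₂-injective ∘ from-injective)
    λ u v → trans (adj-from (inj₂ (splitAt (2 + k) u)) (inj₂ (splitAt (2 + k) v)))
                  (non-clique-independent (splitAt (2 + k) u) (splitAt (2 + k) v))

theorem2 : (k : ℕ) → Σ Graph λ G → Σ Graph λ H → InducedSubgraph H G × (Σ ℕ λ a → Σ ℕ λ b → Σ ℕ λ c → Σ ℕ λ d → LocatingChromaticNumber G a × LocatingChromaticNumber H b × NeighborLocatingChromaticNumber G c × NeighborLocatingChromaticNumber H d × (b ≡ a + k) × (d ≡ c + k))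
theorem2 k =
  graph , Edgeless (2 + k + k) , non-clique , 2 + k , 2 + k + k , 2 + k , 2 + k + k ,
  proj₁ χ-G , proj₁ χ-H , proj₂ χ-G , proj₂ χ-H , refl , refl
  where
  open Construction k
  χ-G = χ-by-clique the-clique f colour-separating
  χ-H = edgeless-χ (2 + k + k)
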